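{- If $T$ is a tournament without an in-universal vertex, then \[ \frac{1}{\gamma^{in}_f(T)} + \frac{1}{\Gamma^{in}_f(T)} = 1. \]
   Context: For a digraph $T$ and vertex $v$, $N^{in}_o(v) = \{u : (u,v) \text{ is an arc}\}$ and $N^{in}_c(v) = N^{in}_o(v)\cup\{v\}$. For a hypergraph $H$, $\tau_f(H)$ is the optimal value of $\min\sum_v x_v$ s.t. $\sum_{v\in e} x_v \ge 1$ for every edge $e$, $x\ge 0$. $\gamma^{in}_f(T)$ is $\tau_f$ of the hypergraph on $V(T)$ with edges $N^{in}_c(v)$, $v\in V(T)$; $\Gamma^{in}_f(T)$ is $\tau_f$ of the hypergraph on $V(T)$ with edges $N^{in}_o(v)$, $v \in V(T)$. A vertex $v$ is in-universal if $v\in N^{in}_c(u)$ for all $u\in V(T)$. -}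

module Defs where

open import Data.Nat using (ℕ; zero; suc)
open import Data.Fin using (Fin; zero; suc; _≟_)
open import Relation.Nullary using (yes; no)
open import Data.Bool using (Bool; true; false; not; if_then_else_)
open import Data.Rational using (ℚ; 0ℚ; 1ℚ; _+_; _≤_)
open import Data.Product using (Σ; _×_)
open import Relation.Binary.PropositionalEquality using (_≡_; _≢_)

sumFin : (n : ℕ) → (Fin n → ℚ) → ℚ
sumFin zero    f = 0ℚ
sumFin (suc n) f = f zero + sumFin n (λ i → f (suc i))

-- A digraph on vertex set Fin n: arc u v = true iff (u,v) is an arc.
Digraph : ℕ → Set
Digraph n = Fin n → Fin n → Bool

IsTournament : (n : ℕ) → Digraph n → Set
IsTournament n T = ((u : Fin n) → T u u ≡ false)
                 × ((u v : Fin n) → u ≢ v → T u v ≡ not (T v u))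

inNbhdOpen : {n : ℕ} → Digraph n → Fin n → Fin n → Bool
inNbhdOpen T v u = T u v

inNbhdClosed : {n : ℕ} → Digraph n → Fin n → Fin n → Bool
inNbhdClosed {n} T v u with u ≟ v
... | yes _ = true
... | no  _ = T u v

IsInUniversal : {n : ℕ} → Digraph n → Fin n → Set
IsInUniversal {n} T v = (u : Fin n) → inNbhdClosed T u v ≡ true

-- Hypergraph on vertex set Fin n with edges indexed by Fin m (edges may repeat).
Hypergraph : ℕ → ℕ → Set
Hypergraph n m = Fin m → Fin n → Bool

sumOver : {n : ℕ} → (Fin n → Bool) → (Fin n → ℚ) → ℚ
sumOver {n} e x = sumFin n (λ v → if e v then x v else 0ℚ)

IsFracTransversal : {n m : ℕ} → Hypergraph n m → (Fin n → ℚ) → Set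
IsFracTransversal {n} {m} H x =
  ((v : Fin n) → 0ℚ ≤ x v) × ((e : Fin m) → 1ℚ ≤ sumOver (H e) x)

IsTauF : {n m : ℕ} → Hypergraph n m → ℚ → Set
IsTauF {n} H t =
  Σ (Fin n → ℚ) (λ x → IsFracTransversal H x × sumFin n x ≡ t)
  × ((x : Fin n → ℚ) → IsFracTransversal H x → t ≤ sumFin n x)

IsGammaInF : {n : ℕ} → Digraph n → ℚ → Set
IsGammaInF T = IsTauF (inNbhdClosed T)

IsUpperGammaInF : {n : ℕ} → Digraph n → ℚ → Set
IsUpperGammaInF T = IsTauF (inNbhdOpen T)

-- In a tournament, v ∈ N^in_c(u) exactly when u ∉ N^in_o(v).  So for any weights z and any
-- vertex v, the z-weight of the closed edges containing v plus the z-weight of the open edge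
-- N^in_o(v) is Σ z.  Consequently an open fractional transversal z, divided by Σ z − 1, is a
-- fractional matching of the closed hypergraph, and weak duality gives γ ≤ Σ z · (γ − 1), i.e.
-- Γ ≥ γ / (γ − 1).  Conversely an optimal fractional matching w of the closed hypergraph, which
-- by LP duality has Σ w = γ, divided by γ − 1 is an open fractional transversal of weight
-- γ / (γ − 1).  Hence Γ = γ / (γ − 1), that is 1/γ + 1/Γ = 1.  Without an in-universal vertex no
-- open edge is empty, which forces γ > 1.
--
-- LP duality over ℚ, including attainment of the optimum, comes from Fourier–Motzkin elimination
-- of the variables x from the system "x is a fractional transversal and Σ x ≤ t".

module Submission where

open import Defs
open import Data.Nat using (ℕ; zero; suc)
open import Data.Fin using (Fin; zero; suc)
open import Data.Fin.Properties using (¬∀⟶∃¬)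
open import Data.Bool using (Bool; true; false; not; if_then_else_)
import Data.Bool.Properties as Bool
open import Data.Rational
  using (ℚ; 0ℚ; 1ℚ; _+_; _*_; _-_; -_; _≤_; _<_; 1/_; NonZero; positive; nonNegative)
open import Data.Rational.Properties
open import Data.Rational.Solver using (module +-*-Solver)
open import Data.Product using (Σ; Σ-syntax; ∃-syntax; _×_; _,_; proj₁; proj₂)
open import Data.Empty using (⊥-elim)
open import Data.List using (List; []; _∷_; _++_; map; allFin; cartesianProductWith)
open import Data.List.Relation.Unary.All as All using (All; []; _∷_)
import Data.List.Relation.Unary.All.Properties as AllP
open import Data.List.Membership.Propositional using (_∈_)
open import Data.List.Membership.Propositional.Properties
  using (∈-allFin; ∈-cartesianProductWith⁺)
open import Data.List.Relation.Unary.Any using (here; there)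
open import Relation.Binary using (DecTotalOrder; tri<; tri≈; tri>)
open import Data.List.Extrema (DecTotalOrder.totalOrder ≤-decTotalOrder)
  using (max; min; argmax; xs≤max; max≤v⁺; min≤xs; argmax-all; f[xs]≤f[argmax])
open import Data.Vec.Functional using (updateAt; tail) renaming (_∷_ to _◂_)
open import Data.Vec.Functional.Properties using (updateAt-id-local)
open import Function using (_∘_; const)
open import Relation.Nullary using (¬_; yes; no)
open import Relation.Binary.PropositionalEquality
open +-*-Solver

private
  variable
    k n m : ℕ

-- Rational arithmetic and finite sums

recip⁺ : (a : ℚ) → 0ℚ < a → ℚ
recip⁺ a a>0 = (1/ a) {{pos⇒nonZero a {{positive a>0}}}}

recip⁺-positive : (a : ℚ) (a>0 : 0ℚ < a) → 0ℚ < recip⁺ a a>0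
recip⁺-positive a a>0 = positive⁻¹ _ {{1/pos⇒pos a {{positive a>0}}}}

recip⁺-inverseˡ : (a : ℚ) (a>0 : 0ℚ < a) → recip⁺ a a>0 * a ≡ 1ℚ
recip⁺-inverseˡ a a>0 = *-inverseˡ a {{pos⇒nonZero a {{positive a>0}}}}

1/-unique : (a b : ℚ) .{{_ : NonZero a}} → a * b ≡ 1ℚ → 1/ a ≡ b
1/-unique a b ab≡1 = begin
  1/ a             ≡⟨ sym (*-identityʳ _) ⟩
  1/ a * 1ℚ        ≡⟨ cong (1/ a *_) (sym ab≡1) ⟩
  1/ a * (a * b)   ≡⟨ sym (*-assoc (1/ a) a b) ⟩
  (1/ a * a) * b   ≡⟨ cong (_* b) (*-inverseˡ a) ⟩
  1ℚ * b           ≡⟨ *-identityˡ b ⟩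
  b                ∎
  where open ≡-Reasoning

*-nonNeg : {a b : ℚ} → 0ℚ ≤ a → 0ℚ ≤ b → 0ℚ ≤ a * b
*-nonNeg {a} {b} a≥0 b≥0 =
  nonNegative⁻¹ _ {{nonNeg*nonNeg⇒nonNeg a {{nonNegative a≥0}} b {{nonNegative b≥0}}}}

*-monoˡ-≤ : (c : ℚ) {a b : ℚ} → 0ℚ ≤ c → a ≤ b → c * a ≤ c * b
*-monoˡ-≤ c c≥0 = *-monoˡ-≤-nonNeg c {{nonNegative c≥0}}

*-monoʳ-≤ : (c : ℚ) {a b : ℚ} → 0ℚ ≤ c → a ≤ b → a * c ≤ b * c
*-monoʳ-≤ c c≥0 = *-monoʳ-≤-nonNeg c {{nonNegative c≥0}}

0<1 : 0ℚ < 1ℚ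
0<1 = positive⁻¹ 1ℚ

0≤1 : 0ℚ ≤ 1ℚ
0≤1 = <⇒≤ 0<1

<⇒0<- : ∀ {p q} → p < q → 0ℚ < q - p
<⇒0<- {p} {q} p<q = subst (_< q - p) (+-inverseʳ p) (+-monoˡ-< (- p) p<q)

positive⇒nonZero : ∀ {p} → 0ℚ < p → NonZero p
positive⇒nonZero {p} p>0 = pos⇒nonZero p {{positive p>0}}

if-nonNeg : (b : Bool) {x : ℚ} → 0ℚ ≤ x → 0ℚ ≤ (if b then x else 0ℚ)
if-nonNeg true  x≥0 = x≥0
if-nonNeg false _   = ≤-refl

if-≤ : (b : Bool) {x : ℚ} → 0ℚ ≤ x → (if b then x else 0ℚ) ≤ x
if-≤ true  _   = ≤-refl
if-≤ false x≥0 = x≥0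

if-+ : (b : Bool) (x y : ℚ) →
  (if b then x + y else 0ℚ) ≡ (if b then x else 0ℚ) + (if b then y else 0ℚ)
if-+ true  x y = refl
if-+ false x y = sym (+-identityˡ 0ℚ)

*-if : (b : Bool) (c x : ℚ) → c * (if b then x else 0ℚ) ≡ (if b then c * x else 0ℚ)
*-if true  c x = refl
*-if false c x = *-zeroʳ c

if-* : (b : Bool) (x y : ℚ) → (if b then x else 0ℚ) * y ≡ (if b then x * y else 0ℚ)
if-* true  x y = refl
if-* false x y = *-zeroˡ y

sumFin-cong : ∀ n {f g : Fin n → ℚ} → (∀ i → f i ≡ g i) → sumFin n f ≡ sumFin n g
sumFin-cong zero    f≗g = refl
sumFin-cong (suc n) f≗g = cong₂ _+_ (f≗g zero) (sumFin-cong n (f≗g ∘ suc))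

sumFin-zero : ∀ n → sumFin n (const 0ℚ) ≡ 0ℚ
sumFin-zero zero    = refl
sumFin-zero (suc n) = trans (+-identityˡ _) (sumFin-zero n)

sumFin-+ : ∀ n (f g : Fin n → ℚ) → sumFin n (λ i → f i + g i) ≡ sumFin n f + sumFin n g
sumFin-+ zero    f g = sym (+-identityˡ 0ℚ)
sumFin-+ (suc n) f g = trans (cong (f zero + g zero +_) (sumFin-+ n (f ∘ suc) (g ∘ suc)))
  (solve 4 (λ a b c d → (a :+ b) :+ (c :+ d) := (a :+ c) :+ (b :+ d)) refl
    (f zero) (g zero) (sumFin n (f ∘ suc)) (sumFin n (g ∘ suc)))

sumFin-*ˡ : ∀ n (c : ℚ) (f : Fin n → ℚ) → sumFin n (λ i → c * f i) ≡ c * sumFin n f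
sumFin-*ˡ zero    c f = sym (*-zeroʳ c)
sumFin-*ˡ (suc n) c f =
  trans (cong (c * f zero +_) (sumFin-*ˡ n c (f ∘ suc))) (sym (*-distribˡ-+ c _ _))

sumFin-*ʳ : ∀ n (c : ℚ) (f : Fin n → ℚ) → sumFin n (λ i → f i * c) ≡ sumFin n f * c
sumFin-*ʳ n c f =
  trans (sumFin-cong n (λ i → *-comm (f i) c)) (trans (sumFin-*ˡ n c f) (*-comm c _))

sumFin-comm : ∀ n m (f : Fin n → Fin m → ℚ) →
  sumFin n (λ i → sumFin m (f i)) ≡ sumFin m (λ j → sumFin n (λ i → f i j))
sumFin-comm zero    m f = sym (sumFin-zero m)
sumFin-comm (suc n) m f = trans (cong (sumFin m (f zero) +_) (sumFin-comm n m (f ∘ suc)))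
  (sym (sumFin-+ m (f zero) (λ j → sumFin n (λ i → f (suc i) j))))

sumFin-mono-≤ : ∀ n {f g : Fin n → ℚ} → (∀ i → f i ≤ g i) → sumFin n f ≤ sumFin n g
sumFin-mono-≤ zero    f≤g = ≤-refl
sumFin-mono-≤ (suc n) f≤g = +-mono-≤ (f≤g zero) (sumFin-mono-≤ n (f≤g ∘ suc))

sumFin-nonNeg : ∀ n {f : Fin n → ℚ} → (∀ i → 0ℚ ≤ f i) → 0ℚ ≤ sumFin n f
sumFin-nonNeg n {f} f≥0 = subst (_≤ sumFin n f) (sumFin-zero n) (sumFin-mono-≤ n f≥0)

term≤sumFin : ∀ n {f : Fin n → ℚ} → (∀ i → 0ℚ ≤ f i) → (i : Fin n) → f i ≤ sumFin n f
term≤sumFin (suc n) {f} f≥0 zero = subst (_≤ f zero + sumFin n (f ∘ suc)) (+-identityʳ (f zero))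
  (+-monoʳ-≤ (f zero) (sumFin-nonNeg n (f≥0 ∘ suc)))
term≤sumFin (suc n) {f} f≥0 (suc i) = subst (_≤ f zero + sumFin n (f ∘ suc)) (+-identityˡ (f (suc i)))
  (+-mono-≤ (f≥0 zero) (term≤sumFin n (f≥0 ∘ suc) i))

unitAt : Fin k → Fin k → ℚ
unitAt zero    zero    = 1ℚ
unitAt zero    (suc _) = 0ℚ
unitAt (suc _) zero    = 0ℚ
unitAt (suc i) (suc j) = unitAt i j

unitAt-nonNeg : (i j : Fin k) → 0ℚ ≤ unitAt i j
unitAt-nonNeg zero    zero    = 0≤1
unitAt-nonNeg zero    (suc _) = ≤-refl
unitAt-nonNeg (suc _) zero    = ≤-refl
unitAt-nonNeg (suc i) (suc j) = unitAt-nonNeg i j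

sumFin-unitAt : ∀ k (i : Fin k) (f : Fin k → ℚ) → sumFin k (λ j → unitAt i j * f j) ≡ f i
sumFin-unitAt (suc k) zero f = begin
  1ℚ * f zero + sumFin k (λ j → 0ℚ * f (suc j))  ≡⟨ cong₂ _+_ (*-identityˡ (f zero))
                                                     (sumFin-cong k (λ j → *-zeroˡ (f (suc j)))) ⟩
  f zero + sumFin k (const 0ℚ)                    ≡⟨ cong (f zero +_) (sumFin-zero k) ⟩
  f zero + 0ℚ                                     ≡⟨ +-identityʳ (f zero) ⟩
  f zero                                          ∎
  where open ≡-Reasoning
sumFin-unitAt (suc k) (suc i) f =
  trans (cong (_+ sumFin k (λ j → unitAt i j * f (suc j))) (*-zeroˡ (f zero))) (trans (+-identityˡ _) (sumFin-unitAt k i (f ∘ suc)))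

-- Fourier–Motzkin elimination

interpolant : {A B : Set} (f : A → ℚ) (g : B → ℚ) (xs : List A) (ys : List B) →
  (∀ {a b} → a ∈ xs → b ∈ ys → f a ≤ g b) →
  ∃[ r ] All (λ a → f a ≤ r) xs × All (λ b → r ≤ g b) ys
interpolant f g xs ys f≤g = r , AllP.map⁻ (xs≤max floor (map f xs)) , All.tabulate r≤g
  where
  -- keeps r below every g b even when xs is empty
  floor r : ℚ
  floor = min 0ℚ (map g ys)
  r = max floor (map f xs)
  r≤g : ∀ {b} → b ∈ ys → r ≤ g b
  r≤g b∈ = max≤v⁺ (All.lookup (AllP.map⁻ (min≤xs 0ℚ (map g ys))) b∈)
                  (AllP.map⁺ (All.tabulate (λ a∈ → f≤g a∈ b∈)))

record Inequality (k : ℕ) : Set where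
  field
    bound : ℚ
    coeff : Fin k → ℚ
open Inequality

infix 7 _·_
_·_ : (Fin k → ℚ) → (Fin k → ℚ) → ℚ
_·_ {k} a y = sumFin k (λ j → a j * y j)

infix 4 _⊨_
_⊨_ : (Fin k → ℚ) → Inequality k → Set
y ⊨ ι = bound ι ≤ coeff ι · y

infixl 6 _⊕_
_⊕_ : Inequality k → Inequality k → Inequality k
ι ⊕ κ = record { bound = bound ι + bound κ ; coeff = λ j → coeff ι j + coeff κ j }

infixr 7 _⊛_
_⊛_ : ℚ → Inequality k → Inequality k
c ⊛ ι = record { bound = c * bound ι ; coeff = λ j → c * coeff ι j }

record ConeClosed (P : Inequality k → Set) : Set where
  field
    ⊕-closed : ∀ {ι κ} → P ι → P κ → P (ι ⊕ κ)
    ⊛-closed : ∀ {c ι} → 0ℚ < c → P ι → P (c ⊛ ι)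

zeroAt-coneClosed : (q : Fin k) → ConeClosed (λ ι → coeff ι q ≡ 0ℚ)
zeroAt-coneClosed q = record
  { ⊕-closed = λ ι₀ κ₀ → trans (cong₂ _+_ ι₀ κ₀) (+-identityˡ 0ℚ)
  ; ⊛-closed = λ {c} _ ι₀ → trans (cong (c *_) ι₀) (*-zeroʳ c)
  }

·-⊕ : (a b y : Fin k → ℚ) → (λ j → a j + b j) · y ≡ a · y + b · y
·-⊕ {k} a b y =
  trans (sumFin-cong k (λ j → *-distribʳ-+ (y j) (a j) (b j))) (sumFin-+ k _ _)

·-⊛ : (c : ℚ) (a y : Fin k → ℚ) → (λ j → c * a j) · y ≡ c * (a · y)
·-⊛ {k} c a y = trans (sumFin-cong k (λ j → *-assoc c (a j) (y j))) (sumFin-*ˡ k c _)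

⊨-⊛⁻ : ∀ {c} {ι : Inequality k} {y} → 0ℚ < c → y ⊨ c ⊛ ι → y ⊨ ι
⊨-⊛⁻ {c = c} {ι} {y} c>0 y⊨cι =
  *-cancelˡ-≤-pos c {{positive c>0}} (subst (c * bound ι ≤_) (·-⊛ c (coeff ι) y) y⊨cι)

·-updateAt : (a y : Fin k → ℚ) (p : Fin k) (r : ℚ) →
  a · updateAt y p (const r) ≡ a p * r + a · updateAt y p (const 0ℚ)
·-updateAt {suc k} a y zero r = cong (a zero * r +_) (sym
  (trans (cong (_+ tail a · tail y) (*-zeroʳ (a zero))) (+-identityˡ _)))
·-updateAt {suc k} a y (suc p) r =
  trans (cong (a zero * y zero +_) (·-updateAt (tail a) (tail y) p r))
    (solve 3 (λ u v w → u :+ (v :+ w) := v :+ (u :+ w)) refl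
      (a zero * y zero) (a (suc p) * r) (tail a · updateAt (tail y) p (const 0ℚ)))

·-updateAt-self : (a y : Fin k → ℚ) (p : Fin k) → a · y ≡ a · updateAt y p (const (y p))
·-updateAt-self {k} a y p =
  sumFin-cong k (λ j → cong (a j *_) (sym (updateAt-id-local p y refl j)))

-- Rows with a nonzero coefficient at p are rescaled to coefficient 1 (a lower bound on y p)
-- or −1 (an upper bound on y p).
zerosAt lowersAt uppersAt : Fin k → List (Inequality k) → List (Inequality k)
zerosAt p [] = []
zerosAt p (ι ∷ L) with <-cmp (coeff ι p) 0ℚ
... | tri< _ _ _ = zerosAt p L
... | tri≈ _ _ _ = ι ∷ zerosAt p L
... | tri> _ _ _ = zerosAt p L
lowersAt p [] = []
lowersAt p (ι ∷ L) with <-cmp (coeff ι p) 0ℚ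
... | tri< _ _ _   = lowersAt p L
... | tri≈ _ _ _   = lowersAt p L
... | tri> _ _ c>0 = recip⁺ (coeff ι p) c>0 ⊛ ι ∷ lowersAt p L
uppersAt p [] = []
uppersAt p (ι ∷ L) with <-cmp (coeff ι p) 0ℚ
... | tri< c<0 _ _ = recip⁺ (- coeff ι p) (neg-antimono-< c<0) ⊛ ι ∷ uppersAt p L
... | tri≈ _ _ _   = uppersAt p L
... | tri> _ _ _   = uppersAt p L

module _ (p : Fin k) where

  partition-All : {P : Inequality k → Set} → ConeClosed P → ∀ {L} → All P L →
    All P (zerosAt p L) × All P (lowersAt p L) × All P (uppersAt p L)
  partition-All cone [] = [] , [] , []
  partition-All cone {ι ∷ L} (Pι ∷ PL) with <-cmp (coeff ι p) 0ℚ | partition-All cone PL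
  ... | tri< c<0 _ _ | Z , Lo , Up =
    Z , Lo , ConeClosed.⊛-closed cone (recip⁺-positive _ (neg-antimono-< c<0)) Pι ∷ Up
  ... | tri≈ _ _ _   | Z , Lo , Up = Pι ∷ Z , Lo , Up
  ... | tri> _ _ c>0 | Z , Lo , Up =
    Z , ConeClosed.⊛-closed cone (recip⁺-positive _ c>0) Pι ∷ Lo , Up

  partition-coeff : ∀ L → All (λ ι → coeff ι p ≡ 0ℚ) (zerosAt p L)
                        × All (λ ι → coeff ι p ≡ 1ℚ) (lowersAt p L)
                        × All (λ ι → coeff ι p ≡ - 1ℚ) (uppersAt p L)
  partition-coeff [] = [] , [] , []
  partition-coeff (ι ∷ L) with <-cmp (coeff ι p) 0ℚ | partition-coeff L
  ... | tri< c<0 _ _ | Z , Lo , Up = Z , Lo , scaled≡-1 ∷ Up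
    where
    c s : ℚ
    c = coeff ι p
    s = recip⁺ (- c) (neg-antimono-< c<0)
    scaled≡-1 : s * c ≡ - 1ℚ
    scaled≡-1 = trans (solve 2 (λ s c → s :* c := :- (s :* (:- c))) refl s c)
                      (cong -_ (recip⁺-inverseˡ (- c) (neg-antimono-< c<0)))
  ... | tri≈ _ c≡0 _ | Z , Lo , Up = c≡0 ∷ Z , Lo , Up
  ... | tri> _ _ c>0 | Z , Lo , Up = Z , recip⁺-inverseˡ (coeff ι p) c>0 ∷ Lo , Up

  partition-sound : ∀ L {y} → All (y ⊨_) (zerosAt p L) → All (y ⊨_) (lowersAt p L) →
    All (y ⊨_) (uppersAt p L) → All (y ⊨_) L
  partition-sound [] _ _ _ = []
  partition-sound (ι ∷ L) Z Lo Up with <-cmp (coeff ι p) 0ℚ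
  partition-sound (ι ∷ L) Z Lo (s ∷ Up) | tri< c<0 _ _ =
    ⊨-⊛⁻ {ι = ι} (recip⁺-positive _ (neg-antimono-< c<0)) s ∷ partition-sound L Z Lo Up
  partition-sound (ι ∷ L) (s ∷ Z) Lo Up | tri≈ _ _ _ = s ∷ partition-sound L Z Lo Up
  partition-sound (ι ∷ L) Z (s ∷ Lo) Up | tri> _ _ c>0 =
    ⊨-⊛⁻ {ι = ι} (recip⁺-positive _ c>0) s ∷ partition-sound L Z Lo Up

-≤⇒≤+ : ∀ {x z r} → x - z ≤ r → x ≤ r + z
-≤⇒≤+ {x} {z} {r} h =
  subst (_≤ r + z) (solve 2 (λ x z → x :- z :+ z := x) refl x z) (+-monoˡ-≤ z h)

≤-⇒≤- : ∀ {x z r} → r ≤ z - x → x ≤ z - r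
≤-⇒≤- {x} {z} {r} h = subst₂ _≤_
  (solve 2 (λ r x → r :+ (x :- r) := x) refl r x)
  (solve 3 (λ z x r → z :- x :+ (x :- r) := z :- r) refl z x r)
  (+-monoˡ-≤ (x - r) h)

+≤+⇒-≤- : ∀ {x x′ z z′} → x + x′ ≤ z + z′ → x - z ≤ z′ - x′
+≤+⇒-≤- {x} {x′} {z} {z′} h = subst₂ _≤_
  (solve 3 (λ x x′ z → x :+ x′ :+ (:- z :- x′) := x :- z) refl x x′ z)
  (solve 3 (λ z z′ x′ → z :+ z′ :+ (:- z :- x′) := z′ :- x′) refl z z′ x′)
  (+-monoˡ-≤ (- z - x′) h)

All-⊕⁺ : {P : Inequality k → Set} (xs ys : List (Inequality k)) →
  (∀ {a b} → a ∈ xs → b ∈ ys → P (a ⊕ b)) → All P (cartesianProductWith _⊕_ xs ys)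
All-⊕⁺ = AllP.cartesianProductWith⁺ (setoid _) (setoid _) _⊕_

eliminate : Fin k → List (Inequality k) → List (Inequality k)
eliminate p L = zerosAt p L ++ cartesianProductWith _⊕_ (lowersAt p L) (uppersAt p L)

eliminate-All : {P : Inequality k → Set} → ConeClosed P → ∀ p {L} → All P L →
  All P (eliminate p L)
eliminate-All cone p {L} PL =
  let Z , Lo , Up = partition-All p cone PL in
  AllP.++⁺ Z (All-⊕⁺ (lowersAt p L) (uppersAt p L)
    (λ a∈ b∈ → ConeClosed.⊕-closed cone (All.lookup Lo a∈) (All.lookup Up b∈)))

eliminate-zero : ∀ (p : Fin k) L → All (λ ι → coeff ι p ≡ 0ℚ) (eliminate p L)
eliminate-zero p L =
  let Z , Lo , Up = partition-coeff p L in
  AllP.++⁺ Z (All-⊕⁺ (lowersAt p L) (uppersAt p L)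
    (λ a∈ b∈ → trans (cong₂ _+_ (All.lookup Lo a∈) (All.lookup Up b∈)) (+-inverseʳ 1ℚ)))

eliminate-project : ∀ (p : Fin k) L {y} → All (y ⊨_) (eliminate p L) →
  ∃[ r ] All (updateAt y p (const r) ⊨_) L
eliminate-project {k} p L {y} y⊨ = r , partition-sound p L satZ satLo satUp
  where
  rest lower upper : Inequality k → ℚ
  rest ι = coeff ι · updateAt y p (const 0ℚ)
  lower a = bound a - rest a
  upper b = rest b - bound b

  at : ∀ ι {c} → coeff ι p ≡ c → ∀ s → coeff ι · updateAt y p (const s) ≡ c * s + rest ι
  at ι refl = ·-updateAt (coeff ι) y p

  at-zero : ∀ {ι} → ι ∈ zerosAt p L → ∀ s → coeff ι · updateAt y p (const s) ≡ rest ι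
  at-zero {ι} ι∈ s = trans (at ι (All.lookup (proj₁ (partition-coeff p L)) ι∈) s)
    (trans (cong (_+ rest ι) (*-zeroˡ s)) (+-identityˡ (rest ι)))

  at-lower : ∀ {a} → a ∈ lowersAt p L → ∀ s → coeff a · updateAt y p (const s) ≡ s + rest a
  at-lower {a} a∈ s = trans (at a (All.lookup (proj₁ (proj₂ (partition-coeff p L))) a∈) s)
    (cong (_+ rest a) (*-identityˡ s))

  at-upper : ∀ {b} → b ∈ uppersAt p L → ∀ s → coeff b · updateAt y p (const s) ≡ rest b - s
  at-upper {b} b∈ s = trans (at b (All.lookup (proj₂ (proj₂ (partition-coeff p L))) b∈) s)
    (solve 2 (λ s R → (:- con 1ℚ) :* s :+ R := R :- s) refl s (rest b))

  lower≤upper : ∀ {a b} → a ∈ lowersAt p L → b ∈ uppersAt p L → lower a ≤ upper b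
  lower≤upper {a} {b} a∈ b∈ = +≤+⇒-≤- {bound a} {bound b} (subst (bound a + bound b ≤_) value
    (All.lookup (AllP.++⁻ʳ (zerosAt p L) y⊨) (∈-cartesianProductWith⁺ _⊕_ a∈ b∈)))
    where
    value : (λ j → coeff a j + coeff b j) · y ≡ rest a + rest b
    value = begin
      (λ j → coeff a j + coeff b j) · y
        ≡⟨ ·-⊕ (coeff a) (coeff b) y ⟩
      coeff a · y + coeff b · y
        ≡⟨ cong₂ _+_ (·-updateAt-self (coeff a) y p) (·-updateAt-self (coeff b) y p) ⟩
      coeff a · updateAt y p (const (y p)) + coeff b · updateAt y p (const (y p))
        ≡⟨ cong₂ _+_ (at-lower a∈ (y p)) (at-upper b∈ (y p)) ⟩
      (y p + rest a) + (rest b - y p)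
        ≡⟨ solve 3 (λ s u v → (s :+ u) :+ (v :- s) := u :+ v) refl (y p) (rest a) (rest b) ⟩
      rest a + rest b
        ∎
      where open ≡-Reasoning

  between : ∃[ r ] All (λ a → lower a ≤ r) (lowersAt p L) × All (λ b → r ≤ upper b) (uppersAt p L)
  between = interpolant lower upper (lowersAt p L) (uppersAt p L) lower≤upper

  r : ℚ
  r = proj₁ between

  satZ : All (updateAt y p (const r) ⊨_) (zerosAt p L)
  satZ = All.tabulate λ {ι} ι∈ → subst (bound ι ≤_)
    (trans (·-updateAt-self (coeff ι) y p) (trans (at-zero ι∈ (y p)) (sym (at-zero ι∈ r))))
    (All.lookup (AllP.++⁻ˡ (zerosAt p L) y⊨) ι∈)

  satLo : All (updateAt y p (const r) ⊨_) (lowersAt p L)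
  satLo = All.tabulate λ {a} a∈ → subst (bound a ≤_) (sym (at-lower a∈ r))
    (-≤⇒≤+ {bound a} (All.lookup (proj₁ (proj₂ between)) a∈))

  satUp : All (updateAt y p (const r) ⊨_) (uppersAt p L)
  satUp = All.tabulate λ {b} b∈ → subst (bound b ≤_) (sym (at-upper b∈ r))
    (≤-⇒≤- {bound b} {rest b} (All.lookup (proj₂ (proj₂ between)) b∈))

eliminateTail : List (Fin n) → List (Inequality (suc n)) → List (Inequality (suc n))
eliminateTail []       L = L
eliminateTail (q ∷ qs) L = eliminateTail qs (eliminate (suc q) L)

eliminateTail-All : {P : Inequality (suc n) → Set} → ConeClosed P → ∀ qs {L} → All P L →
  All P (eliminateTail qs L)
eliminateTail-All cone []       PL = PL
eliminateTail-All cone (q ∷ qs) PL = eliminateTail-All cone qs (eliminate-All cone (suc q) PL)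

eliminateTail-zero : ∀ {q : Fin n} {qs} L → q ∈ qs →
  All (λ ι → coeff ι (suc q) ≡ 0ℚ) (eliminateTail qs L)
eliminateTail-zero {q = q} {_ ∷ qs} L (here refl) =
  eliminateTail-All (zeroAt-coneClosed (suc q)) qs (eliminate-zero (suc q) L)
eliminateTail-zero {qs = q′ ∷ _} L (there q∈) = eliminateTail-zero (eliminate (suc q′) L) q∈

eliminateTail-project : ∀ (qs : List (Fin n)) L {y} → All (y ⊨_) (eliminateTail qs L) →
  ∃[ y′ ] y′ zero ≡ y zero × All (y′ ⊨_) L
eliminateTail-project []       L {y} y⊨ = y , refl , y⊨
eliminateTail-project (q ∷ qs) L {y} y⊨ =
  let y′ , y′₀≡y₀ , y′⊨ = eliminateTail-project qs (eliminate (suc q) L) {y} y⊨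
      r , y″⊨ = eliminate-project (suc q) L {y′} y′⊨
  in updateAt y′ (suc q) (const r) , y′₀≡y₀ , y″⊨

-- Duality for fractional transversals

load : Hypergraph n m → (Fin m → ℚ) → Fin n → ℚ
load {m = m} H w v = sumFin m (λ e → if H e v then w e else 0ℚ)

IsFracMatching : Hypergraph n m → (Fin m → ℚ) → Set
IsFracMatching H w = (∀ e → 0ℚ ≤ w e) × (∀ v → load H w v ≤ 1ℚ)

load-zero : (H : Hypergraph n m) (v : Fin n) → load H (const 0ℚ) v ≡ 0ℚ
load-zero {m = m} H v = trans (sumFin-cong m (λ e → if-0 (H e v))) (sumFin-zero m)
  where
  if-0 : (b : Bool) → (if b then 0ℚ else 0ℚ) ≡ 0ℚ
  if-0 true  = refl
  if-0 false = refl

load-+ : (H : Hypergraph n m) (w w′ : Fin m → ℚ) (v : Fin n) →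
  load H (λ e → w e + w′ e) v ≡ load H w v + load H w′ v
load-+ {m = m} H w w′ v =
  trans (sumFin-cong m (λ e → if-+ (H e v) (w e) (w′ e))) (sumFin-+ m _ _)

load-*ˡ : (H : Hypergraph n m) (c : ℚ) (w : Fin m → ℚ) (v : Fin n) →
  load H (λ e → c * w e) v ≡ c * load H w v
load-*ˡ {m = m} H c w v =
  trans (sumFin-cong m (λ e → sym (*-if (H e v) c (w e)))) (sumFin-*ˡ m c _)

member≤sumOver : (e : Fin n → Bool) {z : Fin n → ℚ} → (∀ u → 0ℚ ≤ z u) →
  ∀ {u} → e u ≡ true → z u ≤ sumOver e z
member≤sumOver {n} e {z} z≥0 {u} u∈e =
  subst (_≤ sumOver e z) (cong (λ b → if b then z u else 0ℚ) u∈e)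
    (term≤sumFin n (λ u′ → if-nonNeg (e u′) (z≥0 u′)) u)

sumOver≤sumFin : (e : Fin n → Bool) {z : Fin n → ℚ} → (∀ u → 0ℚ ≤ z u) → sumOver e z ≤ sumFin n z
sumOver≤sumFin {n} e z≥0 = sumFin-mono-≤ n (λ u → if-≤ (e u) (z≥0 u))

sumOver-*ˡ : (e : Fin n → Bool) (c : ℚ) (z : Fin n → ℚ) →
  sumOver e (λ u → c * z u) ≡ c * sumOver e z
sumOver-*ˡ {n} e c z = trans (sumFin-cong n (λ u → sym (*-if (e u) c (z u)))) (sumFin-*ˡ n c _)

weakDuality : (H : Hypergraph n m) {x : Fin n → ℚ} {w : Fin m → ℚ} {c : ℚ} →
  IsFracTransversal H x → (∀ e → 0ℚ ≤ w e) → (∀ v → load H w v ≤ c) →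
  sumFin m w ≤ c * sumFin n x
weakDuality {n} {m} H {x} {w} {c} (x≥0 , covered) w≥0 load≤c = begin
  sumFin m w
    ≡⟨ sumFin-cong m (λ e → sym (*-identityʳ (w e))) ⟩
  sumFin m (λ e → w e * 1ℚ)
    ≤⟨ sumFin-mono-≤ m (λ e → *-monoˡ-≤ (w e) (w≥0 e) (covered e)) ⟩
  sumFin m (λ e → w e * sumOver (H e) x)
    ≡⟨ sumFin-cong m (λ e → sym (sumFin-*ˡ n (w e) _)) ⟩
  sumFin m (λ e → sumFin n (λ v → w e * (if H e v then x v else 0ℚ)))
    ≡⟨ sumFin-cong m (λ e → sumFin-cong n (λ v → swap-if (H e v) (w e) (x v))) ⟩
  sumFin m (λ e → sumFin n (λ v → (if H e v then w e else 0ℚ) * x v))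
    ≡⟨ sumFin-comm m n _ ⟩
  sumFin n (λ v → sumFin m (λ e → (if H e v then w e else 0ℚ) * x v))
    ≡⟨ sumFin-cong n (λ v → sumFin-*ʳ m (x v) _) ⟩
  sumFin n (λ v → load H w v * x v)
    ≤⟨ sumFin-mono-≤ n (λ v → *-monoʳ-≤ (x v) (x≥0 v) (load≤c v)) ⟩
  sumFin n (λ v → c * x v)
    ≡⟨ sumFin-*ˡ n c x ⟩
  c * sumFin n x
    ∎
  where
  open ≤-Reasoning
  swap-if : (b : Bool) (a x : ℚ) → a * (if b then x else 0ℚ) ≡ (if b then a else 0ℚ) * x
  swap-if b a x = trans (*-if b a x) (sym (if-* b a x))

-- Variable zero is the objective value t and variable suc v is x v.
module CoveringSystem {n m : ℕ} (H : Hypergraph n m) where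

  coverRow : Fin m → Inequality (suc n)
  coverRow e = record { bound = 1ℚ ; coeff = 0ℚ ◂ λ v → if H e v then 1ℚ else 0ℚ }

  nonNegRow : Fin n → Inequality (suc n)
  nonNegRow u = record { bound = 0ℚ ; coeff = 0ℚ ◂ unitAt u }

  objectiveRow : Inequality (suc n)
  objectiveRow = record { bound = 0ℚ ; coeff = 1ℚ ◂ const (- 1ℚ) }

  system : List (Inequality (suc n))
  system = map coverRow (allFin m) ++ map nonNegRow (allFin n) ++ objectiveRow ∷ []

  system-sound : ∀ {y} → All (y ⊨_) system →
    IsFracTransversal H (tail y) × sumFin n (tail y) ≤ y zero
  system-sound {y} y⊨ =
    ((λ u → subst (0ℚ ≤_) (nonNegRow-value u) (row-holds (AllP.map⁻ y⊨nonNeg) u)) ,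
     (λ e → subst (1ℚ ≤_) (coverRow-value e) (row-holds (AllP.map⁻ y⊨cover) e))) ,
    objective-holds (All.head y⊨objective)
    where
    y⊨cover : All (y ⊨_) (map coverRow (allFin m))
    y⊨cover = AllP.++⁻ˡ (map coverRow (allFin m)) y⊨
    y⊨nonNeg : All (y ⊨_) (map nonNegRow (allFin n))
    y⊨nonNeg = AllP.++⁻ˡ (map nonNegRow (allFin n)) (AllP.++⁻ʳ (map coverRow (allFin m)) y⊨)
    y⊨objective : All (y ⊨_) (objectiveRow ∷ [])
    y⊨objective = AllP.++⁻ʳ (map nonNegRow (allFin n)) (AllP.++⁻ʳ (map coverRow (allFin m)) y⊨)

    row-holds : ∀ {k} {P : Fin k → Set} → All P (allFin k) → ∀ i → P i
    row-holds P-all i = All.lookup P-all (∈-allFin i)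

    0*t+ : ∀ s → 0ℚ * y zero + s ≡ s
    0*t+ s = trans (cong (_+ s) (*-zeroˡ (y zero))) (+-identityˡ s)

    coverRow-value : ∀ e → coeff (coverRow e) · y ≡ sumOver (H e) (tail y)
    coverRow-value e = trans (0*t+ _) (sumFin-cong n (λ v → indicator-* (H e v) (y (suc v))))
      where
      indicator-* : (b : Bool) (x : ℚ) → (if b then 1ℚ else 0ℚ) * x ≡ (if b then x else 0ℚ)
      indicator-* true  x = *-identityˡ x
      indicator-* false x = *-zeroˡ x

    nonNegRow-value : ∀ u → coeff (nonNegRow u) · y ≡ y (suc u)
    nonNegRow-value u = trans (0*t+ _) (sumFin-unitAt n u (tail y))

    objective-holds : y ⊨ objectiveRow → sumFin n (tail y) ≤ y zero
    objective-holds 0≤t-Σ = subst₂ _≤_ (+-identityˡ Σx)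
      (solve 2 (λ t s → con 1ℚ :* t :+ (:- con 1ℚ) :* s :+ s := t) refl (y zero) Σx)
      (+-monoˡ-≤ Σx (subst (0ℚ ≤_) (cong (1ℚ * y zero +_) (sumFin-*ˡ n (- 1ℚ) (tail y))) 0≤t-Σ))
      where
      Σx : ℚ
      Σx = sumFin n (tail y)

  -- ι is implied by the system with multipliers weights on the cover rows and coeff ι zero on
  -- the objective row; the rows x v ≥ 0 absorb the slack in load≤.
  record Certificate (ι : Inequality (suc n)) : Set where
    field
      head-nonNeg    : 0ℚ ≤ coeff ι zero
      weights        : Fin m → ℚ
      weights-nonNeg : ∀ e → 0ℚ ≤ weights e
      load≤          : ∀ v → load H weights v ≤ coeff ι zero + coeff ι (suc v)
      bound≤         : bound ι ≤ sumFin m weights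

  zeroCertificate : ∀ {ι} → 0ℚ ≤ coeff ι zero → (∀ v → 0ℚ ≤ coeff ι zero + coeff ι (suc v)) →
    bound ι ≤ 0ℚ → Certificate ι
  zeroCertificate a₀≥0 a₀+aᵥ≥0 b≤0 = record
    { head-nonNeg    = a₀≥0
    ; weights        = const 0ℚ
    ; weights-nonNeg = λ _ → ≤-refl
    ; load≤          = λ v → subst (_≤ _) (sym (load-zero H v)) (a₀+aᵥ≥0 v)
    ; bound≤         = subst (_ ≤_) (sym (sumFin-zero m)) b≤0
    }

  certificate-coneClosed : ConeClosed Certificate
  certificate-coneClosed = record { ⊕-closed = ⊕-closed ; ⊛-closed = ⊛-closed }
    where
    open Certificate
    ⊕-closed : ∀ {ι κ} → Certificate ι → Certificate κ → Certificate (ι ⊕ κ)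
    ⊕-closed {ι} {κ} C D = record
      { head-nonNeg    = +-mono-≤ (head-nonNeg C) (head-nonNeg D)
      ; weights        = λ e → weights C e + weights D e
      ; weights-nonNeg = λ e → +-mono-≤ (weights-nonNeg C e) (weights-nonNeg D e)
      ; load≤          = λ v → subst₂ _≤_ (sym (load-+ H (weights C) (weights D) v))
          (solve 4 (λ a a′ b b′ → (a :+ a′) :+ (b :+ b′) := (a :+ b) :+ (a′ :+ b′)) refl
             (coeff ι zero) (coeff ι (suc v)) (coeff κ zero) (coeff κ (suc v)))
          (+-mono-≤ (load≤ C v) (load≤ D v))
      ; bound≤         = subst (bound ι + bound κ ≤_) (sym (sumFin-+ m (weights C) (weights D)))
          (+-mono-≤ (bound≤ C) (bound≤ D))
      }
    ⊛-closed : ∀ {c ι} → 0ℚ < c → Certificate ι → Certificate (c ⊛ ι)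
    ⊛-closed {c} {ι} c>0 C = record
      { head-nonNeg    = *-nonNeg (<⇒≤ c>0) (head-nonNeg C)
      ; weights        = λ e → c * weights C e
      ; weights-nonNeg = λ e → *-nonNeg (<⇒≤ c>0) (weights-nonNeg C e)
      ; load≤          = λ v → subst₂ _≤_ (sym (load-*ˡ H c (weights C) v))
          (*-distribˡ-+ c (coeff ι zero) (coeff ι (suc v)))
          (*-monoˡ-≤ c (<⇒≤ c>0) (load≤ C v))
      ; bound≤         = subst (c * bound ι ≤_) (sym (sumFin-*ˡ m c (weights C)))
          (*-monoˡ-≤ c (<⇒≤ c>0) (bound≤ C))
      }

  system-certified : All Certificate system
  system-certified = AllP.++⁺ (AllP.map⁺ (All.universal coverRow-certified (allFin m)))
    (AllP.++⁺ (AllP.map⁺ (All.universal nonNegRow-certified (allFin n)))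
      (objectiveRow-certified ∷ []))
    where
    coverRow-certified : ∀ e → Certificate (coverRow e)
    coverRow-certified e = record
      { head-nonNeg    = ≤-refl
      ; weights        = unitAt e
      ; weights-nonNeg = unitAt-nonNeg e
      ; load≤          = λ v → ≤-reflexive (trans
          (sumFin-cong m (λ e′ → if-unitAt (H e′ v) (unitAt e e′)))
          (trans (sumFin-unitAt m e (λ e′ → if H e′ v then 1ℚ else 0ℚ)) (sym (+-identityˡ _))))
      ; bound≤         = ≤-reflexive (sym (trans (sumFin-cong m (λ e′ → sym (*-identityʳ _)))
          (sumFin-unitAt m e (const 1ℚ))))
      }
      where
      if-unitAt : (b : Bool) (u : ℚ) → (if b then u else 0ℚ) ≡ u * (if b then 1ℚ else 0ℚ)
      if-unitAt true  u = sym (*-identityʳ u)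
      if-unitAt false u = sym (*-zeroʳ u)

    nonNegRow-certified : ∀ u → Certificate (nonNegRow u)
    nonNegRow-certified u =
      zeroCertificate ≤-refl (λ v → subst (0ℚ ≤_) (sym (+-identityˡ _)) (unitAt-nonNeg u v)) ≤-refl

    objectiveRow-certified : Certificate objectiveRow
    objectiveRow-certified = zeroCertificate 0≤1 (λ _ → ≤-reflexive (sym (+-inverseʳ 1ℚ))) ≤-refl

  HeadOnly : Inequality (suc n) → Set
  HeadOnly ι = ∀ v → coeff ι (suc v) ≡ 0ℚ

  module _ {ι : Inequality (suc n)} (C : Certificate ι) (ι-headOnly : HeadOnly ι) where
    open Certificate C

    weights-load≤head : ∀ v → load H weights v ≤ coeff ι zero
    weights-load≤head v = subst (load H weights v ≤_)
      (trans (cong (coeff ι zero +_) (ι-headOnly v)) (+-identityʳ _)) (load≤ v)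

    bound≤head*sum : ∀ {x} → IsFracTransversal H x → bound ι ≤ coeff ι zero * sumFin n x
    bound≤head*sum x-feasible =
      ≤-trans bound≤ (weakDuality H x-feasible weights-nonNeg weights-load≤head)

-- After eliminating x every row reads coeff zero · t ≥ bound, so the least feasible t is the
-- largest ratio, and the certificate of a row attaining it is an optimal fractional matching.
-- Rows with coeff zero ≤ 0 get ratio −1, below every feasible t.
module Optimum {n m : ℕ} (H : Hypergraph n m) {x₀ : Fin n → ℚ}
               (x₀-feasible : IsFracTransversal H x₀) where
  open CoveringSystem H

  Reduced : Inequality (suc n) → Set
  Reduced ι = Certificate ι × HeadOnly ι

  reduced : List (Inequality (suc n))
  reduced = eliminateTail (allFin n) system

  reduced-Reduced : All Reduced reduced
  reduced-Reduced = All.zip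
    ( eliminateTail-All certificate-coneClosed (allFin n) system-certified
    , All.tabulate (λ ι∈ v → All.lookup (eliminateTail-zero system (∈-allFin v)) ι∈) )

  ratio : Inequality (suc n) → ℚ
  ratio ι with 0ℚ <? coeff ι zero
  ... | yes a₀>0 = bound ι * recip⁺ (coeff ι zero) a₀>0
  ... | no  _    = - 1ℚ

  trivialRow : Inequality (suc n)
  trivialRow = record { bound = 0ℚ ; coeff = const 0ℚ }

  best : Inequality (suc n)
  best = argmax ratio trivialRow reduced

  t* : ℚ
  t* = ratio best

  best-Reduced : Reduced best
  best-Reduced = argmax-all ratio
    (zeroCertificate ≤-refl (λ _ → ≤-refl) ≤-refl , λ _ → refl) reduced-Reduced

  ratio≤⇒bound≤ : ∀ {ι t} → Reduced ι → ratio ι ≤ t → bound ι ≤ coeff ι zero * t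
  ratio≤⇒bound≤ {ι} {t} (C , ι-headOnly) ratio≤t with 0ℚ <? coeff ι zero
  ... | yes a₀>0 = subst₂ _≤_
    (trans (*-assoc (bound ι) _ a₀) (trans (cong (bound ι *_) (recip⁺-inverseˡ a₀ a₀>0))
                                           (*-identityʳ (bound ι))))
    (*-comm t a₀)
    (*-monoʳ-≤ a₀ (<⇒≤ a₀>0) ratio≤t)
    where a₀ = coeff ι zero
  ... | no a₀≯0 = subst (bound ι ≤_) a₀Σx₀≡a₀t (bound≤head*sum C ι-headOnly x₀-feasible)
    where
    a₀ : ℚ
    a₀ = coeff ι zero
    a₀≡0 : a₀ ≡ 0ℚ
    a₀≡0 = ≤-antisym (≮⇒≥ a₀≯0) (Certificate.head-nonNeg C)
    a₀Σx₀≡a₀t : a₀ * sumFin n x₀ ≡ a₀ * t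
    a₀Σx₀≡a₀t = trans (cong (_* sumFin n x₀) a₀≡0)
      (trans (*-zeroˡ (sumFin n x₀)) (sym (trans (cong (_* t) a₀≡0) (*-zeroˡ t))))

  ·-headOnly : ∀ (ι : Inequality (suc n)) t → coeff ι · (t ◂ const 0ℚ) ≡ coeff ι zero * t
  ·-headOnly ι t = trans (cong (coeff ι zero * t +_)
      (trans (sumFin-cong n (λ v → *-zeroʳ (coeff ι (suc v)))) (sumFin-zero n)))
    (+-identityʳ (coeff ι zero * t))

  t*-satisfies-reduced : All ((t* ◂ const 0ℚ) ⊨_) reduced
  t*-satisfies-reduced = All.zipWith
    (λ {ι} (ι-reduced , ratio≤t*) →
       subst (bound ι ≤_) (sym (·-headOnly ι t*)) (ratio≤⇒bound≤ ι-reduced ratio≤t*))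
    (reduced-Reduced , f[xs]≤f[argmax] trivialRow reduced)

  lifted : ∃[ y ] y zero ≡ t* × All (y ⊨_) system
  lifted = eliminateTail-project (allFin n) system {t* ◂ const 0ℚ} t*-satisfies-reduced

  x* : Fin n → ℚ
  x* = tail (proj₁ lifted)

  x*-sound : IsFracTransversal H x* × sumFin n x* ≤ proj₁ lifted zero
  x*-sound = system-sound {proj₁ lifted} (proj₂ (proj₂ lifted))

  x*-feasible : IsFracTransversal H x*
  x*-feasible = proj₁ x*-sound

  Σx*≤t* : sumFin n x* ≤ t*
  Σx*≤t* = subst (sumFin n x* ≤_) (proj₁ (proj₂ lifted)) (proj₂ x*-sound)

  t*≥0 : 0ℚ ≤ t*
  t*≥0 = ≤-trans (sumFin-nonNeg n (proj₁ x*-feasible)) Σx*≤t*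

  ratio-nonNeg : ∀ ι → 0ℚ ≤ ratio ι →
    Σ[ a₀>0 ∈ 0ℚ < coeff ι zero ] ratio ι ≡ bound ι * recip⁺ _ a₀>0
  ratio-nonNeg ι ratio≥0 with 0ℚ <? coeff ι zero
  ... | yes a₀>0 = a₀>0 , refl
  ... | no  _    = ⊥-elim (<-irrefl refl (<-≤-trans (negative⁻¹ (- 1ℚ)) ratio≥0))

  best-head-positive : Σ[ a₀>0 ∈ 0ℚ < coeff best zero ] t* ≡ bound best * recip⁺ _ a₀>0
  best-head-positive = ratio-nonNeg best t*≥0

  a₀ : ℚ
  a₀ = coeff best zero

  a₀>0 : 0ℚ < a₀
  a₀>0 = proj₁ best-head-positive

  c : ℚ
  c = recip⁺ a₀ a₀>0

  c≥0 : 0ℚ ≤ c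
  c≥0 = <⇒≤ (recip⁺-positive a₀ a₀>0)
  open Certificate (proj₁ best-Reduced)

  t*-lower : ∀ x → IsFracTransversal H x → t* ≤ sumFin n x
  t*-lower x x-feasible = subst₂ _≤_ (sym (proj₂ best-head-positive)) a₀Σxc≡Σx
    (*-monoʳ-≤ c c≥0 (bound≤head*sum (proj₁ best-Reduced) (proj₂ best-Reduced) x-feasible))
    where
    a₀Σxc≡Σx : a₀ * sumFin n x * c ≡ sumFin n x
    a₀Σxc≡Σx = trans (solve 3 (λ a s c → a :* s :* c := s :* (c :* a)) refl a₀ (sumFin n x) c)
      (trans (cong (sumFin n x *_) (recip⁺-inverseˡ a₀ a₀>0)) (*-identityʳ _))

  t*-isTauF : IsTauF H t*
  t*-isTauF = (x* , x*-feasible , ≤-antisym Σx*≤t* (t*-lower x* x*-feasible)) , t*-lower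

  w* : Fin m → ℚ
  w* e = c * weights e

  w*-matching : IsFracMatching H w*
  w*-matching = (λ e → *-nonNeg c≥0 (weights-nonNeg e)) ,
    λ v → subst₂ _≤_ (sym (load-*ˡ H c weights v)) (recip⁺-inverseˡ a₀ a₀>0)
      (*-monoˡ-≤ c c≥0 (weights-load≤head (proj₁ best-Reduced) (proj₂ best-Reduced) v))

  Σw*≡t* : sumFin m w* ≡ t*
  Σw*≡t* = ≤-antisym
    (≤-trans (weakDuality H x*-feasible (proj₁ w*-matching) (proj₂ w*-matching))
             (subst (_≤ t*) (sym (*-identityˡ _)) Σx*≤t*))
    (subst₂ _≤_ (sym (proj₂ best-head-positive))
      (trans (*-comm _ c) (sym (sumFin-*ˡ m c weights))) (*-monoʳ-≤ c c≥0 bound≤))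

strongDuality : (H : Hypergraph n m) {x₀ : Fin n → ℚ} → IsFracTransversal H x₀ →
  Σ[ t ∈ ℚ ] IsTauF H t × Σ[ w ∈ (Fin m → ℚ) ] IsFracMatching H w × sumFin m w ≡ t
strongDuality H x₀-feasible = t* , t*-isTauF , w* , w*-matching , Σw*≡t*
  where open Optimum H x₀-feasible

-- The conjugate γ / (γ − 1)

conjugate : (γ : ℚ) → 1ℚ < γ → ℚ
conjugate γ γ>1 = recip⁺ (γ - 1ℚ) (<⇒0<- γ>1) * γ

conjugate-positive : ∀ {γ} (γ>1 : 1ℚ < γ) → 0ℚ < conjugate γ γ>1
conjugate-positive {γ} γ>1 = positive⁻¹ _
  {{pos*pos⇒pos (recip⁺ (γ - 1ℚ) (<⇒0<- γ>1)) {{positive (recip⁺-positive _ (<⇒0<- γ>1))}} γ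
    {{positive (<-trans 0<1 γ>1)}}}}

conjugate-reciprocals : ∀ {γ} (γ>1 : 1ℚ < γ) →
  (1/ γ) {{positive⇒nonZero (<-trans 0<1 γ>1)}}
    + (1/ conjugate γ γ>1) {{positive⇒nonZero (conjugate-positive γ>1)}} ≡ 1ℚ
conjugate-reciprocals {γ} γ>1 = begin
  γ⁻¹ + Γ⁻¹                ≡⟨ cong (γ⁻¹ +_) Γ⁻¹≡[γ-1]γ⁻¹ ⟩
  γ⁻¹ + (γ - 1ℚ) * γ⁻¹     ≡⟨ solve 2 (λ g i → i :+ (g :- con 1ℚ) :* i := g :* i) refl γ γ⁻¹ ⟩
  γ * γ⁻¹                  ≡⟨ *-inverseʳ γ {{nonZero-γ}} ⟩
  1ℚ                       ∎
  where
  open ≡-Reasoning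
  nonZero-γ : NonZero γ
  nonZero-γ = positive⇒nonZero (<-trans 0<1 γ>1)
  γ⁻¹ c Γ⁻¹ : ℚ
  γ⁻¹ = (1/ γ) {{nonZero-γ}}
  c = recip⁺ (γ - 1ℚ) (<⇒0<- γ>1)
  Γ⁻¹ = (1/ conjugate γ γ>1) {{positive⇒nonZero (conjugate-positive γ>1)}}
  Γ⁻¹≡[γ-1]γ⁻¹ : Γ⁻¹ ≡ (γ - 1ℚ) * γ⁻¹
  Γ⁻¹≡[γ-1]γ⁻¹ = 1/-unique (conjugate γ γ>1) ((γ - 1ℚ) * γ⁻¹)
    {{positive⇒nonZero (conjugate-positive γ>1)}} (begin
      c * γ * ((γ - 1ℚ) * γ⁻¹)  ≡⟨ solve 4 (λ c g d i → c :* g :* (d :* i) := (c :* d) :* (g :* i))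
                                      refl c γ (γ - 1ℚ) γ⁻¹ ⟩
      (c * (γ - 1ℚ)) * (γ * γ⁻¹) ≡⟨ cong₂ _*_ (recip⁺-inverseˡ (γ - 1ℚ) (<⇒0<- γ>1))
                                              (*-inverseʳ γ {{nonZero-γ}}) ⟩
      1ℚ * 1ℚ                    ≡⟨ *-identityˡ 1ℚ ⟩
      1ℚ                         ∎)

-- Tournaments

module _ {n : ℕ} {T : Digraph n} (tournament : IsTournament n T) where

  closed≡not-arc : ∀ u v → inNbhdClosed T u v ≡ not (T u v)
  closed≡not-arc u v with v Data.Fin.≟ u
  ... | yes refl = cong not (sym (proj₁ tournament u))
  ... | no  v≢u  = proj₂ tournament v u v≢u

  load-closed+sumOver-open : ∀ z v →
    load (inNbhdClosed T) z v + sumOver (inNbhdOpen T v) z ≡ sumFin n z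
  load-closed+sumOver-open z v = trans (sym (sumFin-+ n _ _)) (sumFin-cong n split)
    where
    split : ∀ u → (if inNbhdClosed T u v then z u else 0ℚ) + (if T u v then z u else 0ℚ) ≡ z u
    split u rewrite closed≡not-arc u v with T u v
    ... | true  = +-identityˡ (z u)
    ... | false = +-identityʳ (z u)

  closed-ones-feasible : IsFracTransversal (inNbhdClosed T) (const 1ℚ)
  closed-ones-feasible = (λ _ → 0≤1) ,
    λ v → member≤sumOver (inNbhdClosed T v) (λ _ → 0≤1) {v} (trans (closed≡not-arc v v) (cong not (proj₁ tournament v)))

  open-ones-feasible : ((v : Fin n) → ¬ IsInUniversal T v) →
    IsFracTransversal (inNbhdOpen T) (const 1ℚ)
  open-ones-feasible no-universal = (λ _ → 0≤1) ,
    λ v → member≤sumOver (inNbhdOpen T v) (λ _ → 0≤1) (proj₂ (in-neighbour v))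
    where
    in-neighbour : ∀ v → ∃[ u ] T u v ≡ true
    in-neighbour v with ¬∀⟶∃¬ n (λ u → inNbhdClosed T u v ≡ true)
                                (λ u → inNbhdClosed T u v Bool.≟ true) (no-universal v)
    ... | u , v∉N[u] with T u v in arc
    ...   | true  = u , arc
    ...   | false = ⊥-elim (v∉N[u] (trans (closed≡not-arc u v) (cong not arc)))

  -- z / (Σ z − 1) is a fractional matching of the closed hypergraph.
  γ≤Σz[γ-1] : ∀ {γ z} → IsGammaInF T γ → IsFracTransversal (inNbhdOpen T) z →
    γ ≤ sumFin n z * (γ - 1ℚ)
  γ≤Σz[γ-1] {γ} {z} ((x , x-feasible , Σx≡γ) , _) (z≥0 , z-covers) = subst₂ _≤_
    (solve 2 (λ Z g → Z :+ (g :- Z) := g) refl Z γ)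
    (solve 2 (λ Z g → (Z :- con 1ℚ) :* g :+ (g :- Z) := Z :* (g :- con 1ℚ)) refl Z γ)
    (+-monoˡ-≤ (γ - Z) Z≤[Z-1]γ)
    where
    Z : ℚ
    Z = sumFin n z
    load≤Z-1 : ∀ v → load (inNbhdClosed T) z v ≤ Z - 1ℚ
    load≤Z-1 v = subst₂ _≤_
      (solve 2 (λ a o → a :+ o :- o := a) refl (load (inNbhdClosed T) z v) (sumOver (inNbhdOpen T v) z))
      (cong (_- 1ℚ) (load-closed+sumOver-open z v))
      (+-monoʳ-≤ (load (inNbhdClosed T) z v + sumOver (inNbhdOpen T v) z) (neg-antimono-≤ (z-covers v)))
    Z≤[Z-1]γ : Z ≤ (Z - 1ℚ) * γ
    Z≤[Z-1]γ = subst (Z ≤_) (cong ((Z - 1ℚ) *_) Σx≡γ)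
      (weakDuality (inNbhdClosed T) x-feasible z≥0 load≤Z-1)

  gammaInF>1 : ∀ {γ z} → Fin n → IsFracTransversal (inNbhdOpen T) z → IsGammaInF T γ → 1ℚ < γ
  gammaInF>1 {γ} {z} v₀ z-feasible γ-optimal with 1ℚ <? γ
  ... | yes γ>1 = γ>1
  ... | no  γ≯1 = ⊥-elim (<-irrefl refl (<-≤-trans 0<1
                   (≤-trans 1≤γ (≤-trans (γ≤Σz[γ-1] γ-optimal z-feasible) Σz[γ-1]≤0))))
    where
    x : Fin n → ℚ
    x = proj₁ (proj₁ γ-optimal)
    x-feasible : IsFracTransversal (inNbhdClosed T) x
    x-feasible = proj₁ (proj₂ (proj₁ γ-optimal))
    1≤γ : 1ℚ ≤ γ
    1≤γ = subst (1ℚ ≤_) (proj₂ (proj₂ (proj₁ γ-optimal)))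
      (≤-trans (proj₂ x-feasible v₀) (sumOver≤sumFin (inNbhdClosed T v₀) (proj₁ x-feasible)))
    γ-1≤0 : γ - 1ℚ ≤ 0ℚ
    γ-1≤0 = subst (γ - 1ℚ ≤_) (+-inverseʳ 1ℚ) (+-monoˡ-≤ (- 1ℚ) (≮⇒≥ γ≯1))
    Σz[γ-1]≤0 : sumFin n z * (γ - 1ℚ) ≤ 0ℚ
    Σz[γ-1]≤0 = subst (sumFin n z * (γ - 1ℚ) ≤_) (*-zeroʳ (sumFin n z))
      (*-monoˡ-≤ (sumFin n z) (sumFin-nonNeg n (proj₁ z-feasible)) γ-1≤0)

  upperGammaInF-conjugate : ∀ {γ w} → IsGammaInF T γ → IsFracMatching (inNbhdClosed T) w →
    sumFin n w ≡ γ → (γ>1 : 1ℚ < γ) → IsUpperGammaInF T (conjugate γ γ>1)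
  upperGammaInF-conjugate {γ} {w} γ-optimal (w≥0 , w-load≤1) Σw≡γ γ>1 =
    (w′ , (w′≥0 , w′-covers) , trans (sumFin-*ˡ n c w) (cong (c *_) Σw≡γ)) , conjugate≤
    where
    c : ℚ
    c = recip⁺ (γ - 1ℚ) (<⇒0<- γ>1)
    c≥0 : 0ℚ ≤ c
    c≥0 = <⇒≤ (recip⁺-positive _ (<⇒0<- γ>1))
    w′ : Fin n → ℚ
    w′ u = c * w u
    w′≥0 : ∀ u → 0ℚ ≤ w′ u
    w′≥0 u = *-nonNeg c≥0 (w≥0 u)
    γ-1≤open : ∀ v → γ - 1ℚ ≤ sumOver (inNbhdOpen T v) w
    γ-1≤open v = subst₂ _≤_
      (cong (_- 1ℚ) (trans (load-closed+sumOver-open w v) Σw≡γ))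
      (solve 2 (λ a o → a :+ o :- a := o) refl load-w sumOver-w)
      (+-monoʳ-≤ (load-w + sumOver-w) (neg-antimono-≤ (w-load≤1 v)))
      where
      load-w sumOver-w : ℚ
      load-w = load (inNbhdClosed T) w v
      sumOver-w = sumOver (inNbhdOpen T v) w
    w′-covers : ∀ v → 1ℚ ≤ sumOver (inNbhdOpen T v) w′
    w′-covers v = subst₂ _≤_ (recip⁺-inverseˡ (γ - 1ℚ) (<⇒0<- γ>1))
      (sym (sumOver-*ˡ (inNbhdOpen T v) c w)) (*-monoˡ-≤ c c≥0 (γ-1≤open v))
    conjugate≤ : ∀ z → IsFracTransversal (inNbhdOpen T) z → conjugate γ γ>1 ≤ sumFin n z
    conjugate≤ z z-feasible = subst (c * γ ≤_) c[Z[γ-1]]≡Z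
      (*-monoˡ-≤ c c≥0 (γ≤Σz[γ-1] γ-optimal z-feasible))
      where
      Z : ℚ
      Z = sumFin n z
      c[Z[γ-1]]≡Z : c * (Z * (γ - 1ℚ)) ≡ Z
      c[Z[γ-1]]≡Z = trans (solve 3 (λ c Z d → c :* (Z :* d) := Z :* (c :* d)) refl c Z (γ - 1ℚ))
        (trans (cong (Z *_) (recip⁺-inverseˡ (γ - 1ℚ) (<⇒0<- γ>1))) (*-identityʳ Z))

corollary3 : (n : ℕ) → (T : Digraph n) → IsTournament n T → Fin n →
    ((v : Fin n) → ¬ IsInUniversal T v) →
    Σ ℚ (λ g → Σ ℚ (λ G → IsGammaInF T g × IsUpperGammaInF T G ×
      Σ (NonZero g) (λ nzg → Σ (NonZero G) (λ nzG →
        (1/_ g {{nzg}}) + (1/_ G {{nzG}}) ≡ 1ℚ))))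
corollary3 n T tournament v₀ no-universal =
  let γ , γ-optimal , w , w-matching , Σw≡γ =
        strongDuality (inNbhdClosed T) (closed-ones-feasible tournament)
      1<γ = gammaInF>1 tournament v₀ (open-ones-feasible tournament no-universal) γ-optimal
  in γ , conjugate γ 1<γ , γ-optimal ,
     upperGammaInF-conjugate tournament γ-optimal w-matching Σw≡γ 1<γ ,
     positive⇒nonZero (<-trans 0<1 1<γ) ,
     positive⇒nonZero (conjugate-positive 1<γ) ,
     conjugate-reciprocals 1<γ
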